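{- Let $\lambda=(\lambda_1>\lambda_2>\cdots>\lambda_\ell>0)$ be a partition with distinct parts, let $o$ be the number of odd parts of $\lambda$ and $e$ the number of even parts of $\lambda$, and let $\ell(\lambda)=\ell$. Then $$\mathrm{srank}(\lambda)=\max\bigl(o,\; e+(\ell(\lambda)\bmod 2)\bigr),$$ where $a \bmod 2$ denotes $1$ if $a$ is odd and $0$ if $a$ is even.
   Context: For a partition $\lambda$ with distinct parts of length $\ell$, the shifted diagram $S(\lambda)$ has $\ell$ rows, row $i$ consisting of $\lambda_i$ squares, the first square of row $i$ (for $i>1$) placed under the second square of row $i-1$. For an odd positive integer $r$ (put $\lambda_{\ell+1}=0$), the $r$-bars of $\lambda$ are: (type 1) for a row $i$ such that $\lambda_{j+1}<\lambda_i-r<\lambda_j$ for some $j\le \ell$, the rightmost $r$ squares of row $i$; removing them gives the strict partition obtained by deleting $\lambda_i$ and inserting $\lambda_i-r$ in its sorted position; (type 2) for a row $i$ with $\lambda_i=r$, the whole row $i$; removing it deletes the part $\lambda_i$; (type 3) for rows $i<j$ with $\lambda_i+\lambda_j=r$, all squares of rows $i$ and $j$; removing it deletes both parts. A bar tableau of shape $\lambda$ is an assignment of positive integers to the squares of $S(\lambda)$ such that either $\lambda$ is empty, or the set of squares carrying the largest integer is an $r$-bar (for some odd $r$) and, after removing this bar and reordering the remaining (relabelled-in-place) rows so that they form the shifted diagram of the resulting strict partition (a shortened row keeping its remaining leftmost entries), the result is a bar tableau. Each label thus occupies exactly one bar; the number of bars of a bar tableau is the number of distinct labels. The shifted rank $\mathrm{srank}(\lambda)$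 is the minimum number of bars in a bar tableau of shape $\lambda$. -}

module Defs where

open import Data.Nat using (ℕ; zero; suc; _+_; _∸_; _<_; _≤_; _%_; _<ᵇ_; _⊔_)
open import Data.List using (List; []; _∷_; length)
open import Data.List.Relation.Unary.All using (All)
open import Data.List.Relation.Unary.Linked using (Linked)
open import Data.Bool using (if_then_else_)
open import Data.Product using (Σ; _×_; ∃-syntax)
open import Relation.Binary.PropositionalEquality using (_≡_)

StrictPartition : List ℕ → Set
StrictPartition λs = Linked (λ a b → b < a) λs × All (λ a → 0 < a) λs

-- part λ i = λ_{i+1} (0-indexed), with the convention λ_k = 0 beyond the length.
part : List ℕ → ℕ → ℕ
part []       _       = 0
part (x ∷ xs) zero    = x
part (x ∷ xs) (suc i) = part xs i

deleteAt : ℕ → List ℕ → List ℕ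
deleteAt _       []       = []
deleteAt zero    (x ∷ xs) = xs
deleteAt (suc i) (x ∷ xs) = x ∷ deleteAt i xs

insertDesc : ℕ → List ℕ → List ℕ
insertDesc x []       = x ∷ []
insertDesc x (y ∷ ys) = if y <ᵇ x then x ∷ y ∷ ys else y ∷ insertDesc x ys

Odd : ℕ → Set
Odd r = r % 2 ≡ 1

-- RemoveBar r λ μ : μ is obtained from λ by removing an r-bar (r odd).
-- Indices are 0-indexed: position i stands for row i+1.
data RemoveBar (r : ℕ) (λs : List ℕ) : List ℕ → Set where
  -- type 1: rightmost r squares of row i, where λ_{j+1} < λ_i - r < λ_j for some row j ≤ ℓ
  type1 : (i j : ℕ) → i < length λs → j < length λs →
          part λs (suc j) < part λs i ∸ r → part λs i ∸ r < part λs j →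
          RemoveBar r λs (insertDesc (part λs i ∸ r) (deleteAt i λs))
  type2 : (i : ℕ) → i < length λs → part λs i ≡ r →
          RemoveBar r λs (deleteAt i λs)
  type3 : (i j : ℕ) → i < j → j < length λs → part λs i + part λs j ≡ r →
          RemoveBar r λs (deleteAt i (deleteAt j λs))

-- A bar tableau of shape λ with k bars (distinct labels), recorded by its
-- successive removals of the bar carrying the largest label.
data BarTableau : List ℕ → ℕ → Set where
  empty : BarTableau [] 0
  step  : ∀ {λs μ k} (r : ℕ) → Odd r → RemoveBar r λs μ →
          BarTableau μ k → BarTableau λs (suc k)

IsSRank : List ℕ → ℕ → Set
IsSRank λs n = BarTableau λs n × (∀ k → BarTableau λs k → n ≤ k)

countOdd : List ℕ → ℕ
countOdd []       = 0
countOdd (x ∷ xs) = x % 2 + countOdd xs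

countEven : List ℕ → ℕ
countEven []       = 0
countEven (x ∷ xs) = (1 ∸ x % 2) + countEven xs

{-# OPTIONS --safe #-}
module Submission where

-- Write f(λ) = max(o, e + ℓ mod 2); it only depends on the multiset of parts.
-- Removing an r-bar replaces one part by another (type 1), deletes an odd part
-- (type 2) or deletes two parts of opposite parity (type 3); in each case both o
-- and e + ℓ mod 2 drop by at most one, so every bar tableau has at least f(λ)
-- bars. Conversely every nonempty strict partition has a bar whose removal lowers
-- f by exactly one and leaves a strict partition: two parts of opposite parity if
-- both parities occur, a whole odd row if all parts are odd, and the 1-bar at the
-- end of the first row if all parts are even.

open import Defs
open import Data.Bool using (true; false)
open import Data.List using (List; []; _∷_; length; map)
open import Data.List.Relation.Binary.Permutation.Propositional
  using (_↭_; ↭-refl; ↭-prep; ↭-swap; ↭-trans; module PermutationReasoning)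
open import Data.List.Relation.Binary.Permutation.Propositional.Properties
  using (↭-length; map⁺)
open import Data.List.Relation.Binary.Sublist.Propositional
  using (_⊆_; []; _∷_; _∷ʳ_; ⊆-refl)
open import Data.List.Relation.Binary.Sublist.Propositional.Properties
  using (All-resp-⊆)
open import Data.List.Relation.Unary.All as All using ([]; _∷_)
open import Data.List.Relation.Unary.AllPairs using (AllPairs; []; _∷_)
open import Data.List.Relation.Unary.Linked using ([-]; _∷_)
open import Data.List.Relation.Unary.Linked.Properties
  using (Linked⇒AllPairs; AllPairs⇒Linked)
open import Data.Nat
  using (ℕ; zero; suc; _+_; _∸_; _%_; _⊔_; _<_; _≤_; z≤n; s≤s; _<ᵇ_; _≟_)
open import Data.Nat.DivMod using (%-distribˡ-+; m%n<n; m%n≤m)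
open import Data.Nat.ListAction using (sum)
open import Data.Nat.ListAction.Properties using (sum-↭)
open import Data.Nat.Properties
open import Data.Product using (_×_; _,_; ∃-syntax)
open import Data.Sum using (_⊎_; inj₁; inj₂)
open import Function using (_∘_; flip)
open import Relation.Binary.PropositionalEquality
  using (_≡_; _≢_; refl; sym; trans; cong; cong₂; subst; module ≡-Reasoning)
open import Relation.Nullary using (yes; no; contradiction)

private
  variable
    x y r i j k : ℕ
    xs ys λs μ : List ℕ

Even : ℕ → Set
Even n = n % 2 ≡ 0

parity : ∀ n → Even n ⊎ Odd n
parity zero          = inj₁ refl
parity (suc zero)    = inj₂ refl
parity (suc (suc n)) = parity n

m%2≤1 : ∀ m → m % 2 ≤ 1
m%2≤1 m = ≤-pred (m%n<n m 2)

even-suc⇒odd : ∀ n → Even (suc n) → Odd n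
even-suc⇒odd (suc zero)    _ = refl
even-suc⇒odd (suc (suc n)) h = even-suc⇒odd n h

odd-suc⇒even : ∀ n → Odd (suc n) → Even n
odd-suc⇒even zero          _ = refl
odd-suc⇒even (suc (suc n)) h = odd-suc⇒even n h

odd-+ : ∀ m n → Odd (m + n) → (Odd m × Even n) ⊎ (Even m × Odd n)
odd-+ zero          n h = inj₂ (refl , h)
odd-+ (suc zero)    n h = inj₁ (refl , odd-suc⇒even n h)
odd-+ (suc (suc m)) n h = odd-+ m n h

%2-+ : ∀ m n → m % 2 ≡ x → n % 2 ≡ y → (m + n) % 2 ≡ (x + y) % 2
%2-+ m n refl refl = %-distribˡ-+ m n 2

even-odd-≢ : ∀ m n → Even m → Odd n → m ≢ n
even-odd-≢ _ _ m-even n-odd refl = contradiction (trans (sym m-even) n-odd) λ ()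

countOdd-consOdd : ∀ x xs → Odd x → countOdd (x ∷ xs) ≡ suc (countOdd xs)
countOdd-consOdd x xs x-odd = cong (_+ countOdd xs) x-odd

countOdd-consEven : ∀ x xs → Even x → countOdd (x ∷ xs) ≡ countOdd xs
countOdd-consEven x xs x-even = cong (_+ countOdd xs) x-even

countEven-consOdd : ∀ x xs → Odd x → countEven (x ∷ xs) ≡ countEven xs
countEven-consOdd x xs x-odd = cong (λ b → 1 ∸ b + countEven xs) x-odd

countEven-consEven : ∀ x xs → Even x → countEven (x ∷ xs) ≡ suc (countEven xs)
countEven-consEven x xs x-even = cong (λ b → 1 ∸ b + countEven xs) x-even

length≡countOdd+countEven : ∀ xs → length xs ≡ countOdd xs + countEven xs
length≡countOdd+countEven []       = refl
length≡countOdd+countEven (x ∷ xs) with parity x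
... | inj₁ x-even = begin
  suc (length xs)                        ≡⟨ cong suc (length≡countOdd+countEven xs) ⟩
  suc (countOdd xs + countEven xs)       ≡⟨ +-suc (countOdd xs) (countEven xs) ⟨
  countOdd xs + suc (countEven xs)
    ≡⟨ cong₂ _+_ (countOdd-consEven x xs x-even) (countEven-consEven x xs x-even) ⟨
  countOdd (x ∷ xs) + countEven (x ∷ xs) ∎
  where open ≡-Reasoning
... | inj₂ x-odd = begin
  suc (length xs)                        ≡⟨ cong suc (length≡countOdd+countEven xs) ⟩
  suc (countOdd xs) + countEven xs
    ≡⟨ cong₂ _+_ (countOdd-consOdd x xs x-odd) (countEven-consOdd x xs x-odd) ⟨
  countOdd (x ∷ xs) + countEven (x ∷ xs) ∎
  where open ≡-Reasoning

countOdd≡sum : ∀ xs → countOdd xs ≡ sum (map (_% 2) xs)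
countOdd≡sum []       = refl
countOdd≡sum (x ∷ xs) = cong (x % 2 +_) (countOdd≡sum xs)

countEven≡sum : ∀ xs → countEven xs ≡ sum (map (λ x → 1 ∸ x % 2) xs)
countEven≡sum []       = refl
countEven≡sum (x ∷ xs) = cong (1 ∸ x % 2 +_) (countEven≡sum xs)

countOdd-↭ : xs ↭ ys → countOdd xs ≡ countOdd ys
countOdd-↭ {xs} {ys} p =
  trans (countOdd≡sum xs) (trans (sum-↭ (map⁺ _ p)) (sym (countOdd≡sum ys)))

countEven-↭ : xs ↭ ys → countEven xs ≡ countEven ys
countEven-↭ {xs} {ys} p =
  trans (countEven≡sum xs) (trans (sum-↭ (map⁺ _ p)) (sym (countEven≡sum ys)))

deleteAt-↭ : ∀ xs → i < length xs → xs ↭ part xs i ∷ deleteAt i xs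
deleteAt-↭ {zero}  (x ∷ xs) _         = ↭-refl
deleteAt-↭ {suc i} (x ∷ xs) (s≤s i<ℓ) =
  ↭-trans (↭-prep x (deleteAt-↭ xs i<ℓ)) (↭-swap x (part xs i) ↭-refl)

part-deleteAt : ∀ xs → i < j → part (deleteAt j xs) i ≡ part xs i
part-deleteAt []                       _         = refl
part-deleteAt {zero}  {suc j} (x ∷ xs) _         = refl
part-deleteAt {suc i} {suc j} (x ∷ xs) (s≤s i<j) = part-deleteAt xs i<j

deleteAt-deleteAt-↭ : ∀ xs → i < j → j < length xs →
                      xs ↭ part xs i ∷ part xs j ∷ deleteAt i (deleteAt j xs)
deleteAt-deleteAt-↭ {i} {j} xs i<j j<ℓ = begin
  xs                                        ↭⟨ deleteAt-↭ xs j<ℓ ⟩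
  part xs j ∷ rest                          ↭⟨ ↭-prep _ (deleteAt-↭ rest i<ℓ′) ⟩
  part xs j ∷ part rest i ∷ deleteAt i rest
    ≡⟨ cong (λ p → part xs j ∷ p ∷ deleteAt i rest) (part-deleteAt xs i<j) ⟩
  part xs j ∷ part xs i ∷ deleteAt i rest   ↭⟨ ↭-swap _ _ ↭-refl ⟩
  part xs i ∷ part xs j ∷ deleteAt i rest   ∎
  where
    open PermutationReasoning
    rest : List ℕ
    rest = deleteAt j xs
    i<ℓ′ : i < length rest
    i<ℓ′ = <-≤-trans i<j (≤-pred (subst (j <_) (↭-length (deleteAt-↭ xs j<ℓ)) j<ℓ))

insertDesc-↭ : ∀ y xs → insertDesc y xs ↭ y ∷ xs
insertDesc-↭ y []       = ↭-refl
insertDesc-↭ y (z ∷ zs) with z <ᵇ y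
... | true  = ↭-refl
... | false = ↭-trans (↭-prep z (insertDesc-↭ y zs)) (↭-swap z y ↭-refl)

insertDesc-head : part xs 0 < y → insertDesc y xs ≡ y ∷ xs
insertDesc-head {[]}     _   = refl
insertDesc-head {z ∷ zs} {y} z<y with z <ᵇ y | <⇒<ᵇ z<y
... | true | _ = refl

AllPairs-resp-⊆ : ∀ {A : Set} {R : A → A → Set} {xs ys : List A} →
                  ys ⊆ xs → AllPairs R xs → AllPairs R ys
AllPairs-resp-⊆ []             []         = []
AllPairs-resp-⊆ (_ ∷ʳ ys⊆xs)   (_ ∷ rxs)  = AllPairs-resp-⊆ ys⊆xs rxs
AllPairs-resp-⊆ (refl ∷ ys⊆xs) (rx ∷ rxs) = All-resp-⊆ ys⊆xs rx ∷ AllPairs-resp-⊆ ys⊆xs rxs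

strictPartition-⊆ : μ ⊆ λs → StrictPartition λs → StrictPartition μ
strictPartition-⊆ μ⊆λ (decreasing , positive) =
  AllPairs⇒Linked (AllPairs-resp-⊆ μ⊆λ (Linked⇒AllPairs (flip <-trans) decreasing)) ,
  All-resp-⊆ μ⊆λ positive

deleteAt-⊆ : ∀ i xs → deleteAt i xs ⊆ xs
deleteAt-⊆ _       []       = []
deleteAt-⊆ zero    (x ∷ xs) = x ∷ʳ ⊆-refl
deleteAt-⊆ (suc i) (x ∷ xs) = refl ∷ deleteAt-⊆ i xs

strictPartition-head : StrictPartition (x ∷ xs) → part xs 0 < x
strictPartition-head {xs = []}    (_ , x>0 ∷ _) = x>0
strictPartition-head {xs = _ ∷ _} (y<x ∷ _ , _) = y<x

strictPartition-replaceHead : StrictPartition (x ∷ xs) → part xs 0 < y → StrictPartition (y ∷ xs)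
strictPartition-replaceHead {xs = []}    _                               y>0 = [-] , y>0 ∷ []
strictPartition-replaceHead {xs = _ ∷ _} (_ ∷ decreasing , _ ∷ positive) z<y =
  z<y ∷ decreasing , <-trans (All.head positive) z<y ∷ positive

srankFormula : List ℕ → ℕ
srankFormula λs = countOdd λs ⊔ (countEven λs + length λs % 2)

srankFormula-↭ : λs ↭ μ → srankFormula λs ≡ srankFormula μ
srankFormula-↭ p =
  cong₂ _⊔_ (countOdd-↭ p) (cong₂ _+_ (countEven-↭ p) (cong (_% 2) (↭-length p)))

srankFormula-cons-≤ : ∀ x y xs → srankFormula (x ∷ xs) ≤ suc (srankFormula (y ∷ xs))
srankFormula-cons-≤ x y xs =
  ⊔-mono-≤ (weight≤1 (y % 2) (m%2≤1 x))
           (+-monoˡ-≤ (suc (length xs) % 2) (weight≤1 (1 ∸ y % 2) (m∸n≤m 1 (x % 2))))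
  where
    weight≤1 : ∀ {a n} b → a ≤ 1 → a + n ≤ suc (b + n)
    weight≤1 {n = n} _ a≤1 = +-monoˡ-≤ n (≤-trans a≤1 (s≤s z≤n))

srankFormula-consOdd-≤ : ∀ x xs → Odd x → srankFormula (x ∷ xs) ≤ suc (srankFormula xs)
srankFormula-consOdd-≤ x xs x-odd = begin
  srankFormula (x ∷ xs)
    ≡⟨ cong₂ (λ o e → o ⊔ (e + suc ℓ % 2))
             (countOdd-consOdd x xs x-odd) (countEven-consOdd x xs x-odd) ⟩
  suc (countOdd xs) ⊔ (countEven xs + suc ℓ % 2)
    ≤⟨ ⊔-monoʳ-≤ (suc (countOdd xs))
                  (+-monoʳ-≤ (countEven xs) (≤-trans (m%2≤1 (suc ℓ)) (s≤s z≤n))) ⟩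
  suc (countOdd xs) ⊔ (countEven xs + suc (ℓ % 2))
    ≡⟨ cong (suc (countOdd xs) ⊔_) (+-suc (countEven xs) (ℓ % 2)) ⟩
  suc (srankFormula xs) ∎
  where
    open ≤-Reasoning
    ℓ : ℕ
    ℓ = length xs

srankFormula-consOddSum : ∀ x y xs → Odd (x + y) →
                          srankFormula (x ∷ y ∷ xs) ≡ suc (srankFormula xs)
srankFormula-consOddSum x y xs odd-sum with odd-+ x y odd-sum
... | inj₁ (x-odd , y-even) rewrite x-odd | y-even = refl
... | inj₂ (x-even , y-odd) rewrite x-even | y-odd = refl

srankFormula-noEven : ∀ xs → countEven xs ≡ 0 → srankFormula xs ≡ countOdd xs
srankFormula-noEven xs e≡0 = begin
  countOdd xs ⊔ (countEven xs + length xs % 2)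
    ≡⟨ cong₂ (λ e ℓ → countOdd xs ⊔ (e + ℓ % 2)) e≡0 ℓ≡o ⟩
  countOdd xs ⊔ (countOdd xs % 2)
    ≡⟨ m≥n⇒m⊔n≡m (m%n≤m (countOdd xs) 2) ⟩
  countOdd xs ∎
  where
    open ≡-Reasoning
    ℓ≡o : length xs ≡ countOdd xs
    ℓ≡o = trans (length≡countOdd+countEven xs) (trans (cong (countOdd xs +_) e≡0) (+-identityʳ _))

srankFormula-consOdd-noEven : ∀ x xs → Odd x → countEven xs ≡ 0 →
                              srankFormula (x ∷ xs) ≡ suc (srankFormula xs)
srankFormula-consOdd-noEven x xs x-odd e≡0 = begin
  srankFormula (x ∷ xs) ≡⟨ srankFormula-noEven (x ∷ xs) (trans (countEven-consOdd x xs x-odd) e≡0) ⟩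
  countOdd (x ∷ xs)     ≡⟨ countOdd-consOdd x xs x-odd ⟩
  suc (countOdd xs)     ≡⟨ cong suc (srankFormula-noEven xs e≡0) ⟨
  suc (srankFormula xs) ∎
  where open ≡-Reasoning

srankFormula-evenToOdd : ∀ x y xs → Even x → Odd y → countOdd xs ≡ 0 →
                         srankFormula (x ∷ xs) ≡ suc (srankFormula (y ∷ xs))
srankFormula-evenToOdd _ _ xs x-even y-odd o≡0
  rewrite x-even | y-odd | o≡0 | trans (length≡countOdd+countEven xs) (cong (_+ countEven xs) o≡0)
  = identity (countEven xs)
  where
    identity : ∀ e → suc e + suc e % 2 ≡ suc (1 ⊔ (e + suc e % 2))
    identity zero    = refl
    identity (suc e) = refl

srankFormula-removePair : ∀ λs → i < j → j < length λs → Odd (part λs i + part λs j) →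
                          srankFormula λs ≡ suc (srankFormula (deleteAt i (deleteAt j λs)))
srankFormula-removePair {i} {j} λs i<j j<ℓ odd-sum =
  trans (srankFormula-↭ (deleteAt-deleteAt-↭ λs i<j j<ℓ))
        (srankFormula-consOddSum (part λs i) (part λs j) (deleteAt i (deleteAt j λs)) odd-sum)

srankFormula-removeBar : Odd r → RemoveBar r λs μ → srankFormula λs ≤ suc (srankFormula μ)
srankFormula-removeBar {r} {λs} _ (type1 i _ i<ℓ _ _ _) = begin
  srankFormula λs
    ≡⟨ srankFormula-↭ (deleteAt-↭ λs i<ℓ) ⟩
  srankFormula (part λs i ∷ rest)
    ≤⟨ srankFormula-cons-≤ (part λs i) (part λs i ∸ r) rest ⟩
  suc (srankFormula (part λs i ∸ r ∷ rest))
    ≡⟨ cong suc (srankFormula-↭ (insertDesc-↭ (part λs i ∸ r) rest)) ⟨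
  suc (srankFormula (insertDesc (part λs i ∸ r) rest)) ∎
  where
    open ≤-Reasoning
    rest : List ℕ
    rest = deleteAt i λs
srankFormula-removeBar {λs = λs} r-odd (type2 i i<ℓ refl) = begin
  srankFormula λs
    ≡⟨ srankFormula-↭ (deleteAt-↭ λs i<ℓ) ⟩
  srankFormula (part λs i ∷ deleteAt i λs)
    ≤⟨ srankFormula-consOdd-≤ (part λs i) (deleteAt i λs) r-odd ⟩
  suc (srankFormula (deleteAt i λs)) ∎
  where open ≤-Reasoning
srankFormula-removeBar {λs = λs} r-odd (type3 _ _ i<j j<ℓ refl) =
  ≤-reflexive (srankFormula-removePair λs i<j j<ℓ r-odd)

srankFormula≤bars : BarTableau λs k → srankFormula λs ≤ k
srankFormula≤bars empty                        = z≤n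
srankFormula≤bars (step _ r-odd removal tableau) =
  ≤-trans (srankFormula-removeBar r-odd removal) (s≤s (srankFormula≤bars tableau))

record ReducingBar (λs : List ℕ) : Set where
  constructor reducingBar
  field
    size      : ℕ
    remainder : List ℕ
    size-odd  : Odd size
    removal   : RemoveBar size λs remainder
    strict    : StrictPartition remainder
    decreases : srankFormula λs ≡ suc (srankFormula remainder)

noOdd⇒even-part : ∀ xs → countOdd xs ≡ 0 → ∀ i → Even (part xs i)
noOdd⇒even-part []       _   _       = refl
noOdd⇒even-part (x ∷ xs) o≡0 zero    = m+n≡0⇒m≡0 (x % 2) o≡0
noOdd⇒even-part (x ∷ xs) o≡0 (suc i) = noOdd⇒even-part xs (m+n≡0⇒n≡0 (x % 2) o≡0) i

even-part : ∀ xs → countEven xs ≢ 0 → ∃[ j ] j < length xs × Even (part xs j)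
even-part []       e≢0 = contradiction refl e≢0
even-part (x ∷ xs) e≢0 with parity x
... | inj₁ x-even = 0 , s≤s z≤n , x-even
... | inj₂ x-odd with even-part xs (e≢0 ∘ trans (countEven-consOdd x xs x-odd))
...   | j , j<ℓ , p-even = suc j , s≤s j<ℓ , p-even

odd-part : ∀ xs → countOdd xs ≢ 0 → ∃[ j ] j < length xs × Odd (part xs j)
odd-part []       o≢0 = contradiction refl o≢0
odd-part (x ∷ xs) o≢0 with parity x
... | inj₂ x-odd  = 0 , s≤s z≤n , x-odd
... | inj₁ x-even with odd-part xs (o≢0 ∘ trans (countOdd-consEven x xs x-even))
...   | j , j<ℓ , p-odd = suc j , s≤s j<ℓ , p-odd

reducingBar-oppositePair : StrictPartition (x ∷ xs) → j < length xs → Odd (x + part xs j) →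
                           ReducingBar (x ∷ xs)
reducingBar-oppositePair {x} {xs} {j} sp j<ℓ odd-sum =
  reducingBar (x + part xs j) (deleteAt j xs) odd-sum
    (type3 0 (suc j) (s≤s z≤n) (s≤s j<ℓ) refl)
    (strictPartition-⊆ (x ∷ʳ deleteAt-⊆ j xs) sp)
    (srankFormula-removePair (x ∷ xs) (s≤s z≤n) (s≤s j<ℓ) odd-sum)

reducingBar-oddRow : StrictPartition (x ∷ xs) → Odd x → countEven xs ≡ 0 → ReducingBar (x ∷ xs)
reducingBar-oddRow {x} {xs} sp x-odd e≡0 =
  reducingBar x xs x-odd (type2 0 (s≤s z≤n) refl) (strictPartition-⊆ (x ∷ʳ ⊆-refl) sp)
    (srankFormula-consOdd-noEven x xs x-odd e≡0)

reducingBar-firstRow : StrictPartition (x ∷ xs) → Even x → countOdd xs ≡ 0 → ReducingBar (x ∷ xs)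
reducingBar-firstRow {zero}  (_ , () ∷ _) _ _
reducingBar-firstRow {suc y} {xs} sp x-even o≡0 =
  reducingBar 1 (y ∷ xs) refl removal (strictPartition-replaceHead sp next<y)
    (srankFormula-evenToOdd (suc y) y xs x-even y-odd o≡0)
  where
    y-odd : Odd y
    y-odd = even-suc⇒odd y x-even
    -- part xs 0 is even (0 if xs is empty) while y is odd.
    next<y : part xs 0 < y
    next<y = ≤∧≢⇒< (≤-pred (strictPartition-head sp))
                   (even-odd-≢ (part xs 0) y (noOdd⇒even-part xs o≡0 0) y-odd)
    removal : RemoveBar 1 (suc y ∷ xs) (y ∷ xs)
    removal = subst (RemoveBar 1 (suc y ∷ xs)) (insertDesc-head next<y)
                (type1 0 0 (s≤s z≤n) (s≤s z≤n) next<y ≤-refl)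

reducingBar-exists : StrictPartition (x ∷ xs) → ReducingBar (x ∷ xs)
reducingBar-exists {x} {xs} sp with parity x
... | inj₂ x-odd with countEven xs ≟ 0
...   | yes e≡0 = reducingBar-oddRow sp x-odd e≡0
...   | no  e≢0 with even-part xs e≢0
...     | j , j<ℓ , p-even = reducingBar-oppositePair sp j<ℓ (%2-+ x (part xs j) x-odd p-even)
reducingBar-exists {x} {xs} sp | inj₁ x-even with countOdd xs ≟ 0
...   | yes o≡0 = reducingBar-firstRow sp x-even o≡0
...   | no  o≢0 with odd-part xs o≢0
...     | j , j<ℓ , p-odd = reducingBar-oppositePair sp j<ℓ (%2-+ x (part xs j) x-even p-odd)

barTableau : ∀ n → StrictPartition λs → srankFormula λs ≡ n → BarTableau λs n
barTableau {[]}     zero    _  _ = empty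
barTableau {x ∷ xs} zero    sp f≡0 =
  contradiction (trans (sym f≡0) (ReducingBar.decreases (reducingBar-exists sp))) λ ()
barTableau {x ∷ xs} (suc n) sp f≡n with reducingBar-exists sp
... | reducingBar r μ r-odd removal μ-strict decreases =
  step r r-odd removal (barTableau n μ-strict (suc-injective (trans (sym decreases) f≡n)))

mainTheorem1 : (λs : List ℕ) → StrictPartition λs →
    IsSRank λs (countOdd λs ⊔ (countEven λs + length λs % 2))
mainTheorem1 λs sp = barTableau (srankFormula λs) sp refl , λ _ → srankFormula≤bars
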